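{- Let $N$ be a network and let $(u,v)$ and $(s,t)$ be edges of $N$. The head move of $(u,v)$ to $(s,t)$ is valid (i.e. produces a network) if all of the following hold: $(u,v)$ is head movable; $u\neq s$; and $t$ is not above $u$.
   Context: A (binary phylogenetic) network on a finite label set $X$ is a directed acyclic graph without parallel edges having exactly one root (indegree $0$, outdegree $1$), exactly $|X|$ leaves (indegree $1$, outdegree $0$) bijectively labelled by $X$, and all other nodes split nodes (indegree $1$, outdegree $2$) or reticulations (indegree $2$, outdegree $1$). A node $a$ is above $b$ if there is a directed path from $a$ to $b$. A head move of $e=(u,v)$ to an edge $f$: delete $e$, subdivide $f$ with a new node $v'$, suppress the indegree-1 outdegree-1 node $v$ (replace $(a,v),(v,b)$ by $(a,b)$), add $(u,v')$; it is valid if the resulting directed graph is a network. An edge $(u,v)$ is head movable if $v$ is a reticulation whose other parent $p$ and child $c$ satisfy: there is no edge $(p,c)$ in $N$. -}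

module Defs where

open import Data.Nat using (ℕ; zero; suc; _⊔_)
open import Data.Nat.Properties using (_≟_)
open import Data.Product using (_×_; _,_; proj₁; proj₂; Σ; ∃; ∃-syntax)
open import Data.Product.Properties using (≡-dec)
open import Data.Sum using (_⊎_)
open import Data.List using (List; []; _∷_; filter; length; map; foldr; concatMap)
open import Data.List.Membership.Propositional using (_∈_; _∉_)
open import Data.List.Relation.Unary.Unique.Propositional using (Unique)
open import Relation.Binary.PropositionalEquality using (_≡_; _≢_)
open import Relation.Binary.Construct.Closure.Transitive using (TransClosure)
open import Relation.Binary.Construct.Closure.ReflexiveTransitive using (Star)
open import Relation.Nullary using (¬_; Dec; yes; no)
open import Relation.Nullary.Decidable using (_×-dec_; _⊎-dec_; ¬?)
open import Function.Definitions using (Injective)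

-- Directed graphs: nodes are natural numbers, a graph is given by its
-- list of edges (every node of a network lies on an edge, since a
-- network has a root of outdegree 1).  Parallel edges show up as
-- duplicate list entries.

Edge : Set
Edge = ℕ × ℕ

Graph : Set
Graph = List Edge

_≟E_ : (e f : Edge) → Dec (e ≡ f)
_≟E_ = ≡-dec _≟_ _≟_

nodes : Graph → List ℕ
nodes = concatMap (λ e → proj₁ e ∷ proj₂ e ∷ [])

IsNode : Graph → ℕ → Set
IsNode G x = x ∈ nodes G

indeg : Graph → ℕ → ℕ
indeg G x = length (filter (λ e → proj₂ e ≟ x) G)

outdeg : Graph → ℕ → ℕ
outdeg G x = length (filter (λ e → proj₁ e ≟ x) G)

EdgeRel : Graph → ℕ → ℕ → Set
EdgeRel G a b = (a , b) ∈ G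

Above : Graph → ℕ → ℕ → Set
Above G = Star (EdgeRel G)

Acyclic : Graph → Set
Acyclic G = ∀ x → ¬ TransClosure (EdgeRel G) x x

NoParallelEdges : Graph → Set
NoParallelEdges G = Unique G

IsRoot IsLeaf IsSplit IsReticulation : Graph → ℕ → Set
IsRoot G x = indeg G x ≡ 0 × outdeg G x ≡ 1
IsLeaf G x = indeg G x ≡ 1 × outdeg G x ≡ 0
IsSplit G x = indeg G x ≡ 1 × outdeg G x ≡ 2
IsReticulation G x = indeg G x ≡ 2 × outdeg G x ≡ 1

record IsNetwork (X : Set) (G : Graph) (ℓ : X → ℕ) : Set where
  field
    acyclic      : Acyclic G
    noParallel   : NoParallelEdges G
    root         : ℕ
    root-node    : IsNode G root
    root-isRoot  : IsRoot G root
    root-unique  : ∀ y → IsNode G y → indeg G y ≡ 0 → y ≡ root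
    nodeTypes    : ∀ y → IsNode G y →
                   IsRoot G y ⊎ IsLeaf G y ⊎ IsSplit G y ⊎ IsReticulation G y
    label-inj    : Injective _≡_ _≡_ ℓ
    label-node   : ∀ x → IsNode G (ℓ x)
    label-leaf   : ∀ x → IsLeaf G (ℓ x)
    label-onto   : ∀ y → IsNode G y → IsLeaf G y → ∃[ x ] ℓ x ≡ y

fresh : Graph → ℕ
fresh G = suc (foldr _⊔_ 0 (nodes G))

deleteEdge : Edge → Graph → Graph
deleteEdge e = filter (λ f → ¬? (f ≟E e))

subdivide : Edge → ℕ → Graph → Graph
subdivide (s , t) w G = (s , w) ∷ (w , t) ∷ deleteEdge (s , t) G

-- suppress an indegree-1 outdegree-1 node v: replace (a,v),(v,b) by (a,b)
-- (if v does not have indegree 1 and outdegree 1 the graph is unchanged;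
--  this case never arises in the head moves considered)
suppress : ℕ → Graph → Graph
suppress v G with map proj₁ (filter (λ e → proj₂ e ≟ v) G)
                | map proj₂ (filter (λ e → proj₁ e ≟ v) G)
... | a ∷ [] | b ∷ [] =
      (a , b) ∷ filter (λ e → ¬? ((proj₁ e ≟ v) ⊎-dec (proj₂ e ≟ v))) G
... | _ | _ = G

headMove : Graph → Edge → Edge → Graph
headMove G (u , v) f =
  let v' = fresh G in
  (u , v') ∷ suppress v (subdivide f v' (deleteEdge (u , v) G))

HeadMovable : Graph → Edge → Set
HeadMovable G (u , v) =
  (u , v) ∈ G × IsReticulation G v ×
  (∀ p c → (p , v) ∈ G → p ≢ u → (v , c) ∈ G → (p , c) ∉ G)

-- A head move deletes (u , v), subdivides (s , t) by a fresh node w, adds (u , w) and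
-- suppresses v.  Each of these steps adds or removes single entries of the lists of edge
-- sources and edge targets, so up to permutation the new graph has one source v fewer and one
-- source w more, and two targets v fewer and two targets w more: every old node other than v
-- keeps its degrees, v disappears and w is a reticulation.  For acyclicity, each edge of the new
-- graph is a path in N extended by (u , w), (s , w), (w , t) (the edge created by suppressing v
-- is a path through v).  The only edge leaving w goes to t, and from t one reaches neither u (by
-- hypothesis) nor s (as (s , t) is an edge), so no cycle passes through w.  Finally the edge
-- created by suppressing v duplicates no edge, which is exactly what head movability says.

module Submission where

open import Defs
open import Data.Nat using (ℕ; suc; _<_; _⊔_; _≤_; s≤s; z<s)
open import Data.Nat.Properties using (_≟_; suc-injective; ≮⇒≥; n≤0⇒n≡0; n≮0; m≤m⊔n; m≤n⊔m; ≤-trans; <⇒≢)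
open import Data.Product using (_×_; _,_; proj₁; proj₂; ∃-syntax)
open import Data.Sum using (_⊎_; inj₁; inj₂)
open import Data.Empty using (⊥-elim)
open import Data.List using (List; []; _∷_; _++_; filter; length; map; foldr)
open import Data.List.Properties using (filter-accept; filter-reject; filter-all)
open import Data.List.Membership.Propositional using (_∈_; _∉_)
open import Data.List.Membership.Propositional.Properties using (∈-filter⁻; ∈-filter⁺)
open import Data.List.Relation.Unary.Any using (here; there)
import Data.List.Relation.Unary.All as All
open import Data.List.Relation.Unary.AllPairs using (_∷_)
open import Data.List.Relation.Unary.Unique.Propositional using (Unique)
import Data.List.Relation.Unary.Unique.Propositional.Properties as UniqueP
open import Data.List.Relation.Unary.All.Properties using (¬Any⇒All¬)
open import Data.List.Relation.Binary.Permutation.Propositional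
  using (_↭_; prep; swap; ↭-refl; ↭-reflexive; ↭-sym; ↭-trans; module PermutationReasoning)
open import Data.List.Relation.Binary.Permutation.Propositional.Properties
  using (↭-length; filter-↭; map⁺; shift; ++⁺ˡ)
open import Relation.Binary.PropositionalEquality
open import Relation.Binary.Construct.Closure.ReflexiveTransitive using (Star; ε; _◅_; _◅◅_)
open import Relation.Binary.Construct.Closure.Transitive using (TransClosure; [_]; _∷_) renaming (_++_ to _++⁺_)
open import Relation.Nullary using (¬_; Dec; yes; no)
open import Relation.Nullary.Decidable using (_⊎-dec_; ¬?)
open import Function using (_∘_)

occ : ℕ → List ℕ → ℕ
occ x xs = length (filter (_≟ x) xs)

occ-∷-≢ : ∀ {x y} xs → y ≢ x → occ x (y ∷ xs) ≡ occ x xs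
occ-∷-≢ {x} xs y≢x = cong length (filter-reject (_≟ x) {xs = xs} y≢x)

occ-∷-≡ : ∀ x xs → occ x (x ∷ xs) ≡ suc (occ x xs)
occ-∷-≡ x xs = cong length (filter-accept (_≟ x) {xs = xs} refl)

occ-↭ : ∀ x {xs ys} → xs ↭ ys → occ x xs ≡ occ x ys
occ-↭ x p = ↭-length (filter-↭ (_≟ x) p)

occ-∷-cancel : ∀ {x y z xs ys} → x ∷ xs ↭ y ∷ ys → x ≢ z → y ≢ z → occ z xs ≡ occ z ys
occ-∷-cancel {x} {y} {z} {xs} {ys} p x≢z y≢z = begin
  occ z xs       ≡⟨ occ-∷-≢ xs x≢z ⟨
  occ z (x ∷ xs) ≡⟨ occ-↭ z p ⟩
  occ z (y ∷ ys) ≡⟨ occ-∷-≢ ys y≢z ⟩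
  occ z ys       ∎
  where open ≡-Reasoning

occ-∷-gain : ∀ {x z xs ys} → x ∷ xs ↭ z ∷ ys → x ≢ z → occ z xs ≡ suc (occ z ys)
occ-∷-gain {x} {z} {xs} {ys} p x≢z = begin
  occ z xs       ≡⟨ occ-∷-≢ xs x≢z ⟨
  occ z (x ∷ xs) ≡⟨ occ-↭ z p ⟩
  occ z (z ∷ ys) ≡⟨ occ-∷-≡ z ys ⟩
  suc (occ z ys) ∎
  where open ≡-Reasoning

startsAt? : (v : ℕ) (e : Edge) → Dec (proj₁ e ≡ v)
startsAt? v e = proj₁ e ≟ v

endsAt? : (v : ℕ) (e : Edge) → Dec (proj₂ e ≡ v)
endsAt? v e = proj₂ e ≟ v

avoids? : (v : ℕ) (e : Edge) → Dec (¬ (proj₁ e ≡ v ⊎ proj₂ e ≡ v))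
avoids? v e = ¬? (startsAt? v e ⊎-dec endsAt? v e)

differsFrom? : (e f : Edge) → Dec (f ≢ e)
differsFrom? e f = ¬? (f ≟E e)

sources targets : Graph → List ℕ
sources = map proj₁
targets = map proj₂

length-filter-map : ∀ {A B : Set} {P : A → Set} (P? : ∀ x → Dec (P x)) (f : B → A) xs →
  length (filter (λ x → P? (f x)) xs) ≡ length (filter P? (map f xs))
length-filter-map P? f [] = refl
length-filter-map P? f (x ∷ xs) with P? (f x)
... | yes _ = cong suc (length-filter-map P? f xs)
... | no _  = length-filter-map P? f xs

indeg≡occ : ∀ G x → indeg G x ≡ occ x (targets G)
indeg≡occ G x = length-filter-map (_≟ x) proj₂ G

outdeg≡occ : ∀ G x → outdeg G x ≡ occ x (sources G)
outdeg≡occ G x = length-filter-map (_≟ x) proj₁ G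

module _ {A : Set} {P : A → Set} (P? : ∀ x → Dec (P x)) where

  0<length-filter⁻ : ∀ xs → 0 < length (filter P? xs) → ∃[ x ] x ∈ xs × P x
  0<length-filter⁻ xs pos with filter P? xs in eq
  ... | x ∷ _ = x , ∈-filter⁻ P? (subst (x ∈_) (sym eq) (here refl))

  0<length-filter⁺ : ∀ {x xs} → x ∈ xs → P x → 0 < length (filter P? xs)
  0<length-filter⁺ {xs = xs} x∈xs px with filter P? xs | ∈-filter⁺ P? x∈xs px
  ... | _ ∷ _ | _ = z<s

source∈nodes : ∀ {G x y} → (x , y) ∈ G → IsNode G x
source∈nodes (here refl) = here refl
source∈nodes (there e∈G) = there (there (source∈nodes e∈G))

target∈nodes : ∀ {G x y} → (x , y) ∈ G → IsNode G y
target∈nodes (here refl) = there (here refl)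
target∈nodes (there e∈G) = there (there (target∈nodes e∈G))

IsNode⇒edge : ∀ {G x} → IsNode G x → (∃[ y ] (x , y) ∈ G) ⊎ (∃[ y ] (y , x) ∈ G)
IsNode⇒edge {_ ∷ _} (here refl)         = inj₁ (_ , here refl)
IsNode⇒edge {_ ∷ _} (there (here refl)) = inj₂ (_ , here refl)
IsNode⇒edge {_ ∷ G} (there (there x∈))  with IsNode⇒edge {G} x∈
... | inj₁ (y , e∈G) = inj₁ (y , there e∈G)
... | inj₂ (y , e∈G) = inj₂ (y , there e∈G)

0<indeg⇒IsNode : ∀ G {x} → 0 < indeg G x → IsNode G x
0<indeg⇒IsNode G {x} pos with 0<length-filter⁻ (endsAt? x) G pos
... | _ , e∈G , refl = target∈nodes e∈G

0<outdeg⇒IsNode : ∀ G {x} → 0 < outdeg G x → IsNode G x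
0<outdeg⇒IsNode G {x} pos with 0<length-filter⁻ (startsAt? x) G pos
... | _ , e∈G , refl = source∈nodes e∈G

IsNode⇒0<deg : ∀ G {x} → IsNode G x → 0 < indeg G x ⊎ 0 < outdeg G x
IsNode⇒0<deg G x∈ with IsNode⇒edge {G} x∈
... | inj₁ (_ , e∈G) = inj₂ (0<length-filter⁺ (startsAt? _) e∈G refl)
... | inj₂ (_ , e∈G) = inj₁ (0<length-filter⁺ (endsAt? _) e∈G refl)

∉nodes⇒indeg≡0 : ∀ G {x} → ¬ IsNode G x → indeg G x ≡ 0
∉nodes⇒indeg≡0 G x∉ = n≤0⇒n≡0 (≮⇒≥ (λ pos → x∉ (0<indeg⇒IsNode G pos)))

∉nodes⇒outdeg≡0 : ∀ G {x} → ¬ IsNode G x → outdeg G x ≡ 0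
∉nodes⇒outdeg≡0 G x∉ = n≤0⇒n≡0 (≮⇒≥ (λ pos → x∉ (0<outdeg⇒IsNode G pos)))

≤-maximum : ∀ {x} xs → x ∈ xs → x ≤ foldr _⊔_ 0 xs
≤-maximum (y ∷ _)  (here refl) = m≤m⊔n y _
≤-maximum (y ∷ xs) (there x∈)  = ≤-trans (≤-maximum xs x∈) (m≤n⊔m y _)

fresh-∉ : ∀ G → ¬ IsNode G (fresh G)
fresh-∉ G w∈ = <⇒≢ (s≤s (≤-maximum (nodes G) w∈)) refl

deleteEdge-↭ : ∀ {e G} → Unique G → e ∈ G → G ↭ e ∷ deleteEdge e G
deleteEdge-↭ {e} {e ∷ G} (e∉G ∷ _) (here refl) = prep e (↭-reflexive (sym deleteEdge-head))
  where
  deleteEdge-head : deleteEdge e (e ∷ G) ≡ G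
  deleteEdge-head = trans (filter-reject (differsFrom? e) (λ e≢e → e≢e refl))
                          (filter-all (differsFrom? e) (All.map (λ e≢f f≡e → e≢f (sym f≡e)) e∉G))
deleteEdge-↭ {e} {g ∷ G} (g∉G ∷ uG) (there e∈G) = begin
  g ∷ G                     ↭⟨ prep g (deleteEdge-↭ uG e∈G) ⟩
  g ∷ e ∷ deleteEdge e G    ↭⟨ swap g e ↭-refl ⟩
  e ∷ g ∷ deleteEdge e G    ≡⟨ cong (e ∷_) (filter-accept (differsFrom? e) (All.lookup g∉G e∈G)) ⟨
  e ∷ deleteEdge e (g ∷ G)  ∎
  where open PermutationReasoning

Unique-∷ : ∀ {A : Set} {x : A} {xs} → x ∉ xs → Unique xs → Unique (x ∷ xs)
Unique-∷ {x = x} {xs} x∉xs u = ¬Any⇒All¬ {P = x ≡_} xs x∉xs ∷ u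

inEdges outEdges edgesAvoiding : ℕ → Graph → Graph
inEdges v = filter (endsAt? v)
outEdges v = filter (startsAt? v)
edgesAvoiding v = filter (avoids? v)

module _ {A : Set} {P Q : A → Set} (P? : ∀ x → Dec (P x)) (Q? : ∀ x → Dec (Q x)) where

  ↭-filter-trichotomy : ∀ xs → (∀ {x} → x ∈ xs → P x → ¬ Q x) →
    xs ↭ filter P? xs ++ filter Q? xs ++ filter (λ x → ¬? (P? x ⊎-dec Q? x)) xs
  ↭-filter-trichotomy [] _ = ↭-refl
  ↭-filter-trichotomy (x ∷ xs) disj with P? x | Q? x | ↭-filter-trichotomy xs (disj ∘ there)
  ... | yes px | yes qx | _  = ⊥-elim (disj (here refl) px qx)
  ... | yes _  | no _   | ih = prep x ih
  ... | no _   | yes _  | ih = ↭-trans (prep x ih) (↭-sym (shift x (filter P? xs) _))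
  ... | no _   | no _   | ih = ↭-trans (prep x ih)
        (↭-sym (↭-trans (++⁺ˡ (filter P? xs) (shift x (filter Q? xs) _)) (shift x (filter P? xs) _)))

-- In the clauses below, with-abstraction rewrites d into a length equation refuting every other shape.
indeg≡1⇒inEdges : ∀ G {v} → indeg G v ≡ 1 → ∃[ a ] inEdges v G ≡ (a , v) ∷ []
indeg≡1⇒inEdges G {v} d with inEdges v G in eq
... | (a , y) ∷ [] with ∈-filter⁻ (endsAt? v) {xs = G} (subst ((a , y) ∈_) (sym eq) (here refl))
...   | _ , refl = a , refl

outdeg≡1⇒outEdges : ∀ G {v} → outdeg G v ≡ 1 → ∃[ b ] outEdges v G ≡ (v , b) ∷ []
outdeg≡1⇒outEdges G {v} d with outEdges v G in eq
... | (y , b) ∷ [] with ∈-filter⁻ (startsAt? v) {xs = G} (subst ((y , b) ∈_) (sym eq) (here refl))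
...   | _ , refl = b , refl

module _ {v a b : ℕ} {G : Graph} (in≡ : inEdges v G ≡ (a , v) ∷ []) (out≡ : outEdges v G ≡ (v , b) ∷ []) where

  suppress-≡ : suppress v G ≡ (a , b) ∷ edgesAvoiding v G
  suppress-≡ rewrite in≡ | out≡ = refl

  ↭-suppress : (v , v) ∉ G → G ↭ (v , b) ∷ (a , v) ∷ edgesAvoiding v G
  ↭-suppress vv∉G = begin
    G                                                      ↭⟨ ↭-filter-trichotomy (startsAt? v) (endsAt? v) G noLoop ⟩
    outEdges v G ++ inEdges v G ++ edgesAvoiding v G       ≡⟨ cong₂ (λ o i → o ++ i ++ edgesAvoiding v G) out≡ in≡ ⟩
    (v , b) ∷ (a , v) ∷ edgesAvoiding v G                  ∎
    where
    open PermutationReasoning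
    noLoop : ∀ {e} → e ∈ G → proj₁ e ≡ v → proj₂ e ≢ v
    noLoop e∈G refl refl = vv∉G e∈G

module _ {R : ℕ → ℕ → Set} where

  TransClosure⇒Star : ∀ {x y} → TransClosure R x y → Star R x y
  TransClosure⇒Star [ r ]   = r ◅ ε
  TransClosure⇒Star (r ∷ p) = r ◅ TransClosure⇒Star p

  Star-++-TransClosure : ∀ {x y z} → Star R x y → TransClosure R y z → TransClosure R x z
  Star-++-TransClosure ε       q = q
  Star-++-TransClosure (r ◅ p) q = r ∷ Star-++-TransClosure p q

Above-fresh : ∀ {G x w} → IsNode G x → ¬ IsNode G w → ¬ Above G x w
Above-fresh x∈G w∉G ε       = w∉G x∈G
Above-fresh x∈G w∉G (r ◅ p) = Above-fresh (target∈nodes r) w∉G p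

Acyclic-⊆⁺ : ∀ {G H} → (∀ {x y} → EdgeRel H x y → TransClosure (EdgeRel G) x y) → Acyclic G → Acyclic H
Acyclic-⊆⁺ {G} {H} embed acyclic x cycle = acyclic x (lift cycle)
  where
  lift : ∀ {x y} → TransClosure (EdgeRel H) x y → TransClosure (EdgeRel G) x y
  lift [ r ]   = embed r
  lift (r ∷ p) = embed r ++⁺ lift p

module _ {G : Graph} {u s t w : ℕ} (acyclic : Acyclic G) (w∉G : ¬ IsNode G w) (u∈G : IsNode G u)
         (st∈G : (s , t) ∈ G) (t↛u : ¬ Above G t u) where

  private
    E : Graph
    E = (u , w) ∷ (s , w) ∷ (w , t) ∷ G

    t↛w : ¬ Above G t w
    t↛w = Above-fresh (target∈nodes st∈G) w∉G

    t↛s : ¬ Above G t s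
    t↛s t→s = acyclic t (Star-++-TransClosure t→s [ st∈G ])

    step-from-t : ∀ {x y} → Above G t x → EdgeRel E x y → Above G t y
    step-from-t t→u (here refl)                 = ⊥-elim (t↛u t→u)
    step-from-t t→s (there (here refl))         = ⊥-elim (t↛s t→s)
    step-from-t t→w (there (there (here refl))) = ⊥-elim (t↛w t→w)
    step-from-t t→x (there (there (there r)))   = t→x ◅◅ (r ◅ ε)

    reach-from-t : ∀ {x y} → Above G t x → Star (EdgeRel E) x y → Above G t y
    reach-from-t t→x ε       = t→x
    reach-from-t t→x (r ◅ p) = reach-from-t (step-from-t t→x r) p

    out-of-w : ∀ {y} → EdgeRel E w y → y ≡ t
    out-of-w (here refl)                 = ⊥-elim (w∉G u∈G)
    out-of-w (there (here refl))         = ⊥-elim (w∉G (source∈nodes st∈G))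
    out-of-w (there (there (here refl))) = refl
    out-of-w (there (there (there r)))   = ⊥-elim (w∉G (source∈nodes r))

    reach-from-w : ∀ {y} → TransClosure (EdgeRel E) w y → Above G t y
    reach-from-w [ r ]   rewrite out-of-w r = ε
    reach-from-w (r ∷ p) rewrite out-of-w r = reach-from-t ε (TransClosure⇒Star p)
    new-or-old : ∀ {x y} → EdgeRel E x y → (y ≡ w ⊎ x ≡ w) ⊎ EdgeRel G x y
    new-or-old (here refl)                 = inj₁ (inj₁ refl)
    new-or-old (there (here refl))         = inj₁ (inj₁ refl)
    new-or-old (there (there (here refl))) = inj₁ (inj₂ refl)
    new-or-old (there (there (there r)))   = inj₂ r

    through-w : ∀ {x y} → TransClosure (EdgeRel E) x y →
                TransClosure (EdgeRel G) x y ⊎ (Star (EdgeRel E) x w × Star (EdgeRel E) w y)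
    through-w [ r ] with new-or-old r
    ... | inj₁ (inj₁ refl) = inj₂ (r ◅ ε , ε)
    ... | inj₁ (inj₂ refl) = inj₂ (ε , r ◅ ε)
    ... | inj₂ g           = inj₁ [ g ]
    through-w (r ∷ p) with new-or-old r | through-w p
    ... | inj₁ (inj₁ refl) | _                = inj₂ (r ◅ ε , TransClosure⇒Star p)
    ... | inj₁ (inj₂ refl) | _                = inj₂ (ε , r ◅ TransClosure⇒Star p)
    ... | inj₂ g           | inj₁ q           = inj₁ (g ∷ q)
    ... | inj₂ _           | inj₂ (x→w , w→y) = inj₂ (r ◅ x→w , w→y)

  Acyclic-attach : Acyclic ((u , w) ∷ (s , w) ∷ (w , t) ∷ G)
  Acyclic-attach x cycle with through-w cycle
  ... | inj₁ g           = acyclic x g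
  ... | inj₂ (x→w , w→x) = t↛w (reach-from-t (reach-from-w (Star-++-TransClosure w→x cycle)) x→w)

module _ {X : Set} {G H : Graph} {ℓ : X → ℕ} {v w : ℕ} (net : IsNetwork X G ℓ)
         (v-ret : IsReticulation G v) (w∉G : ¬ IsNode G w) (acyclicH : Acyclic H) (uniqueH : Unique H)
         (same-indeg  : ∀ y → y ≢ v → y ≢ w → indeg H y ≡ indeg G y)
         (same-outdeg : ∀ y → y ≢ v → y ≢ w → outdeg H y ≡ outdeg G y)
         (v-isolated : indeg H v ≡ 0 × outdeg H v ≡ 0) (w-ret : IsReticulation H w) where

  open IsNetwork net

  private
    transport : ∀ {y} → y ≢ v → y ≢ w → (Q : ℕ → ℕ → Set) → Q (indeg G y) (outdeg G y) → Q (indeg H y) (outdeg H y)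
    transport y≢v y≢w Q = subst₂ Q (sym (same-indeg _ y≢v y≢w)) (sym (same-outdeg _ y≢v y≢w))

    transport⁻ : ∀ {y} → y ≢ v → y ≢ w → (Q : ℕ → ℕ → Set) → Q (indeg H y) (outdeg H y) → Q (indeg G y) (outdeg G y)
    transport⁻ y≢v y≢w Q = subst₂ Q (same-indeg _ y≢v y≢w) (same-outdeg _ y≢v y≢w)

    v∉H : ¬ IsNode H v
    v∉H v∈H with IsNode⇒0<deg H v∈H
    ... | inj₁ pos = n≮0 (subst (0 <_) (proj₁ v-isolated) pos)
    ... | inj₂ pos = n≮0 (subst (0 <_) (proj₂ v-isolated) pos)

    old-node : ∀ {y} → IsNode H y → y ≢ w → IsNode G y × y ≢ v
    old-node {y} y∈H y≢w = y∈G , y≢v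
      where
      y≢v : y ≢ v
      y≢v refl = v∉H y∈H
      y∈G : IsNode G y
      y∈G with IsNode⇒0<deg H y∈H
      ... | inj₁ pos = 0<indeg⇒IsNode G (subst (0 <_) (same-indeg y y≢v y≢w) pos)
      ... | inj₂ pos = 0<outdeg⇒IsNode G (subst (0 <_) (same-outdeg y y≢v y≢w) pos)

    ≢v-by-indeg : ∀ {y k} → indeg G y ≡ k → k ≢ 2 → y ≢ v
    ≢v-by-indeg d≡k k≢2 refl = k≢2 (trans (sym d≡k) (proj₁ v-ret))

    ≢w-by-indeg : ∀ {y k} → indeg H y ≡ k → k ≢ 2 → y ≢ w
    ≢w-by-indeg d≡k k≢2 refl = k≢2 (trans (sym d≡k) (proj₁ w-ret))

    ≢w-in-G : ∀ {y} → IsNode G y → y ≢ w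
    ≢w-in-G y∈G refl = w∉G y∈G

    root≢v : root ≢ v
    root≢v = ≢v-by-indeg (proj₁ root-isRoot) (λ ())

    leaf≢v : ∀ x → ℓ x ≢ v
    leaf≢v x = ≢v-by-indeg (proj₁ (label-leaf x)) (λ ())

    root-isRootH : IsRoot H root
    root-isRootH = transport root≢v (≢w-in-G root-node) (λ i o → i ≡ 0 × o ≡ 1) root-isRoot

    label-leafH : ∀ x → IsLeaf H (ℓ x)
    label-leafH x = transport (leaf≢v x) (≢w-in-G (label-node x)) (λ i o → i ≡ 1 × o ≡ 0) (label-leaf x)

  IsNetwork-moveReticulation : IsNetwork X H ℓ
  IsNetwork-moveReticulation = record
    { acyclic     = acyclicH
    ; noParallel  = uniqueH
    ; root        = root
    ; root-node   = 0<outdeg⇒IsNode H (subst (0 <_) (sym (proj₂ root-isRootH)) z<s)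
    ; root-isRoot = root-isRootH
    ; root-unique = λ y y∈H d≡0 →
        let y≢w = ≢w-by-indeg d≡0 (λ ()); y∈G , y≢v = old-node y∈H y≢w
        in root-unique y y∈G (transport⁻ y≢v y≢w (λ i _ → i ≡ 0) d≡0)
    ; nodeTypes   = types
    ; label-inj   = label-inj
    ; label-node  = λ x → 0<indeg⇒IsNode H (subst (0 <_) (sym (proj₁ (label-leafH x))) z<s)
    ; label-leaf  = label-leafH
    ; label-onto  = λ y y∈H leaf →
        let y≢w = ≢w-by-indeg (proj₁ leaf) (λ ()); y∈G , y≢v = old-node y∈H y≢w
        in label-onto y y∈G (transport⁻ y≢v y≢w (λ i o → i ≡ 1 × o ≡ 0) leaf)
    }
    where
    types : ∀ y → IsNode H y → IsRoot H y ⊎ IsLeaf H y ⊎ IsSplit H y ⊎ IsReticulation H y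
    types y y∈H with y ≟ w
    ... | yes refl = inj₂ (inj₂ (inj₂ w-ret))
    ... | no y≢w   = let y∈G , y≢v = old-node y∈H y≢w in
      transport y≢v y≢w (λ i o → (i ≡ 0 × o ≡ 1) ⊎ (i ≡ 1 × o ≡ 0) ⊎ (i ≡ 1 × o ≡ 2) ⊎ (i ≡ 2 × o ≡ 1))
        (nodeTypes y y∈G)

module HeadMove {X : Set} {N : Graph} {ℓ : X → ℕ} (net : IsNetwork X N ℓ) {u v s t : ℕ}
                (movable : HeadMovable N (u , v)) (st∈N : (s , t) ∈ N) (u≢s : u ≢ s)
                (t↛u : ¬ Above N t u) where

  open IsNetwork net using (acyclic; noParallel)

  private
    uv∈N : (u , v) ∈ N
    uv∈N = proj₁ movable

    v-ret : IsReticulation N v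
    v-ret = proj₁ (proj₂ movable)

    w : ℕ
    w = fresh N

    w∉N : ¬ IsNode N w
    w∉N = fresh-∉ N

    ≢w : ∀ {x} → IsNode N x → x ≢ w
    ≢w x∈N refl = w∉N x∈N

    u≢w : u ≢ w
    u≢w = ≢w (source∈nodes uv∈N)

    v≢w : v ≢ w
    v≢w = ≢w (target∈nodes uv∈N)

    w≢v : w ≢ v
    w≢v = v≢w ∘ sym

    u≢v : u ≢ v
    u≢v refl = acyclic u [ uv∈N ]

    -- G₂ unfolds to (s , w) ∷ (w , t) ∷ G₁'; the permutations below use this definitionally.
    G₁ G₁' G₂ : Graph
    G₁  = deleteEdge (u , v) N
    G₁' = deleteEdge (s , t) G₁
    G₂  = subdivide (s , t) w G₁

    G₁'⊆N : ∀ {e} → e ∈ G₁' → e ∈ N × e ≢ (u , v)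
    G₁'⊆N e∈ = let e∈G₁ , _ = ∈-filter⁻ (differsFrom? (s , t)) {xs = G₁} e∈
               in ∈-filter⁻ (differsFrom? (u , v)) {xs = N} e∈G₁

    unique-G₁ : Unique G₁
    unique-G₁ = UniqueP.filter⁺ (differsFrom? (u , v)) noParallel

    N↭ : N ↭ (u , v) ∷ (s , t) ∷ G₁'
    N↭ = ↭-trans (deleteEdge-↭ noParallel uv∈N) (prep (u , v) (deleteEdge-↭ unique-G₁ st∈G₁))
      where
      st∈G₁ : (s , t) ∈ G₁
      st∈G₁ = ∈-filter⁺ (differsFrom? (u , v)) st∈N (u≢s ∘ sym ∘ cong proj₁)

    targets-G₂ : v ∷ targets G₂ ↭ w ∷ targets N
    targets-G₂ = ↭-trans (swap v w ↭-refl) (prep w (↭-sym (map⁺ proj₂ N↭)))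

    sources-G₂ : u ∷ sources G₂ ↭ w ∷ sources N
    sources-G₂ = ↭-trans (prep u (swap s w ↭-refl)) (↭-trans (swap u w ↭-refl) (prep w (↭-sym (map⁺ proj₁ N↭))))

    indeg-G₂-v : indeg G₂ v ≡ 1
    indeg-G₂-v = suc-injective (begin
      suc (indeg G₂ v)         ≡⟨ cong suc (indeg≡occ G₂ v) ⟩
      suc (occ v (targets G₂)) ≡⟨ occ-∷-gain (↭-sym targets-G₂) w≢v ⟨
      occ v (targets N)        ≡⟨ indeg≡occ N v ⟨
      indeg N v                ≡⟨ proj₁ v-ret ⟩
      2                        ∎)
      where open ≡-Reasoning

    outdeg-G₂-v : outdeg G₂ v ≡ 1
    outdeg-G₂-v = begin
      outdeg G₂ v          ≡⟨ outdeg≡occ G₂ v ⟩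
      occ v (sources G₂)   ≡⟨ occ-∷-cancel sources-G₂ u≢v w≢v ⟩
      occ v (sources N)    ≡⟨ outdeg≡occ N v ⟨
      outdeg N v           ≡⟨ proj₂ v-ret ⟩
      1                    ∎
      where open ≡-Reasoning

    vv∉G₂ : (v , v) ∉ G₂
    vv∉G₂ (here eq)                = v≢w (cong proj₂ eq)
    vv∉G₂ (there (here eq))        = v≢w (cong proj₁ eq)
    vv∉G₂ (there (there vv∈G₁'))   = acyclic v [ proj₁ (G₁'⊆N vv∈G₁') ]

    G₂-old : ∀ {x y} → (x , y) ∈ G₂ → x ≢ w → y ≢ w → (x , y) ∈ G₁'
    G₂-old (here refl)         _   y≢w = ⊥-elim (y≢w refl)
    G₂-old (there (here refl)) x≢w _   = ⊥-elim (x≢w refl)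
    G₂-old (there (there e∈))  _   _   = e∈

    G₂-into-w : ∀ {x} → (x , w) ∈ G₂ → x ≡ s
    G₂-into-w (here refl)         = refl
    G₂-into-w (there (here eq))   = ⊥-elim (≢w (target∈nodes st∈N) (sym (cong proj₂ eq)))
    G₂-into-w (there (there e∈))  = ⊥-elim (w∉N (target∈nodes (proj₁ (G₁'⊆N e∈))))

    G₂-out-of-w : ∀ {y} → (w , y) ∈ G₂ → y ≡ t
    G₂-out-of-w (here eq)           = ⊥-elim (≢w (source∈nodes st∈N) (sym (cong proj₁ eq)))
    G₂-out-of-w (there (here refl)) = refl
    G₂-out-of-w (there (there e∈))  = ⊥-elim (w∉N (source∈nodes (proj₁ (G₁'⊆N e∈))))

    unique-G₂ : Unique G₂
    unique-G₂ = Unique-∷ sw∉ (Unique-∷ (λ wt∈ → w∉N (source∈nodes (proj₁ (G₁'⊆N wt∈))))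
                                        (UniqueP.filter⁺ (differsFrom? (s , t)) unique-G₁))
      where
      sw∉ : (s , w) ∉ (w , t) ∷ G₁'
      sw∉ (here eq)   = ≢w (source∈nodes st∈N) (cong proj₁ eq)
      sw∉ (there e∈)  = w∉N (target∈nodes (proj₁ (G₁'⊆N e∈)))

    G₂⊆attached : ∀ {e} → e ∈ G₂ → e ∈ (u , w) ∷ (s , w) ∷ (w , t) ∷ N
    G₂⊆attached (here refl)         = there (here refl)
    G₂⊆attached (there (here refl)) = there (there (here refl))
    G₂⊆attached (there (there e∈))  = there (there (there (proj₁ (G₁'⊆N e∈))))

    module Suppressed {a b : ℕ} (in≡ : inEdges v G₂ ≡ (a , v) ∷ []) (out≡ : outEdges v G₂ ≡ (v , b) ∷ []) where

      F M : Graph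
      F = edgesAvoiding v G₂
      M = (u , w) ∷ (a , b) ∷ F

      M-≡ : headMove N (u , v) (s , t) ≡ M
      M-≡ = cong ((u , w) ∷_) (suppress-≡ in≡ out≡)

      av∈G₂ : (a , v) ∈ G₂
      av∈G₂ = proj₁ (∈-filter⁻ (endsAt? v) {xs = G₂} (subst ((a , v) ∈_) (sym in≡) (here refl)))

      vb∈G₂ : (v , b) ∈ G₂
      vb∈G₂ = proj₁ (∈-filter⁻ (startsAt? v) {xs = G₂} (subst ((v , b) ∈_) (sym out≡) (here refl)))

      F⊆G₂ : ∀ {e} → e ∈ F → e ∈ G₂
      F⊆G₂ e∈ = proj₁ (∈-filter⁻ (avoids? v) {xs = G₂} e∈)

      G₂↭ : G₂ ↭ (v , b) ∷ (a , v) ∷ F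
      G₂↭ = ↭-suppress in≡ out≡ vv∉G₂

      targets-M : v ∷ targets M ↭ w ∷ targets G₂
      targets-M = ↭-trans (swap v w ↭-refl) (prep w (↭-trans (swap v b ↭-refl) (↭-sym (map⁺ proj₂ G₂↭))))

      sources-M : v ∷ sources M ↭ w ∷ sources N
      sources-M = ↭-trans (↭-trans (swap v u ↭-refl) (prep u (↭-sym (map⁺ proj₁ G₂↭)))) sources-G₂

      same-indeg : ∀ y → y ≢ v → y ≢ w → indeg M y ≡ indeg N y
      same-indeg y y≢v y≢w = begin
        indeg M y           ≡⟨ indeg≡occ M y ⟩
        occ y (targets M)   ≡⟨ occ-∷-cancel targets-M (y≢v ∘ sym) (y≢w ∘ sym) ⟩
        occ y (targets G₂)  ≡⟨ occ-∷-cancel targets-G₂ (y≢v ∘ sym) (y≢w ∘ sym) ⟩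
        occ y (targets N)   ≡⟨ indeg≡occ N y ⟨
        indeg N y           ∎
        where open ≡-Reasoning

      same-outdeg : ∀ y → y ≢ v → y ≢ w → outdeg M y ≡ outdeg N y
      same-outdeg y y≢v y≢w = begin
        outdeg M y          ≡⟨ outdeg≡occ M y ⟩
        occ y (sources M)   ≡⟨ occ-∷-cancel sources-M (y≢v ∘ sym) (y≢w ∘ sym) ⟩
        occ y (sources N)   ≡⟨ outdeg≡occ N y ⟨
        outdeg N y          ∎
        where open ≡-Reasoning

      v-isolated : indeg M v ≡ 0 × outdeg M v ≡ 0
      v-isolated = suc-injective in-v , suc-injective out-v
        where
        open ≡-Reasoning
        in-v : suc (indeg M v) ≡ 1
        in-v = begin
          suc (indeg M v)          ≡⟨ cong suc (indeg≡occ M v) ⟩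
          suc (occ v (targets M))  ≡⟨ occ-∷-gain (↭-sym targets-M) w≢v ⟨
          occ v (targets G₂)       ≡⟨ indeg≡occ G₂ v ⟨
          indeg G₂ v               ≡⟨ indeg-G₂-v ⟩
          1                        ∎
        out-v : suc (outdeg M v) ≡ 1
        out-v = begin
          suc (outdeg M v)         ≡⟨ cong suc (outdeg≡occ M v) ⟩
          suc (occ v (sources M))  ≡⟨ occ-∷-gain (↭-sym sources-M) w≢v ⟨
          occ v (sources N)        ≡⟨ outdeg≡occ N v ⟨
          outdeg N v               ≡⟨ proj₂ v-ret ⟩
          1                        ∎

      w-ret : IsReticulation M w
      w-ret = in-w , out-w
        where
        open ≡-Reasoning
        in-w : indeg M w ≡ 2
        in-w = begin
          indeg M w                      ≡⟨ indeg≡occ M w ⟩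
          occ w (targets M)              ≡⟨ occ-∷-gain targets-M v≢w ⟩
          suc (occ w (targets G₂))       ≡⟨ cong suc (occ-∷-gain targets-G₂ v≢w) ⟩
          suc (suc (occ w (targets N)))  ≡⟨ cong (suc ∘ suc) (trans (sym (indeg≡occ N w)) (∉nodes⇒indeg≡0 N w∉N)) ⟩
          2                              ∎
        out-w : outdeg M w ≡ 1
        out-w = begin
          outdeg M w                     ≡⟨ outdeg≡occ M w ⟩
          occ w (sources M)              ≡⟨ occ-∷-gain sources-M v≢w ⟩
          suc (occ w (sources N))        ≡⟨ cong suc (trans (sym (outdeg≡occ N w)) (∉nodes⇒outdeg≡0 N w∉N)) ⟩
          1                              ∎

      a≢u : a ≢ u
      a≢u refl = proj₂ (G₁'⊆N (G₂-old av∈G₂ u≢w v≢w)) refl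

      ab∉G₂ : (a , b) ∉ G₂
      ab∉G₂ ab∈ with a ≟ w | b ≟ w
      ... | yes refl | _        = vv∉G₂ (subst (λ z → (v , z) ∈ G₂) (trans (G₂-out-of-w ab∈) (sym (G₂-out-of-w av∈G₂))) vb∈G₂)
      ... | no _     | yes refl = vv∉G₂ (subst (λ z → (z , v) ∈ G₂) (trans (G₂-into-w ab∈) (sym (G₂-into-w vb∈G₂))) av∈G₂)
      ... | no a≢w   | no b≢w   = proj₂ (proj₂ movable) a b (old av∈G₂ a≢w v≢w) a≢u (old vb∈G₂ v≢w b≢w) (old ab∈ a≢w b≢w)
        where
        old : ∀ {x y} → (x , y) ∈ G₂ → x ≢ w → y ≢ w → (x , y) ∈ N
        old e∈ x≢w y≢w = proj₁ (G₁'⊆N (G₂-old e∈ x≢w y≢w))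

      unique-M : Unique M
      unique-M = Unique-∷ uw∉ (Unique-∷ (ab∉G₂ ∘ F⊆G₂) (UniqueP.filter⁺ (avoids? v) unique-G₂))
        where
        uw∉ : (u , w) ∉ (a , b) ∷ F
        uw∉ (here eq)  = a≢u (sym (cong proj₁ eq))
        uw∉ (there e∈) = u≢s (G₂-into-w (F⊆G₂ e∈))

      acyclic-M : Acyclic M
      acyclic-M = Acyclic-⊆⁺ embed (Acyclic-attach acyclic w∉N (source∈nodes uv∈N) st∈N t↛u)
        where
        embed : ∀ {x y} → EdgeRel M x y → TransClosure (EdgeRel ((u , w) ∷ (s , w) ∷ (w , t) ∷ N)) x y
        embed (here refl)         = [ here refl ]
        embed (there (here refl)) = G₂⊆attached av∈G₂ ∷ [ G₂⊆attached vb∈G₂ ]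
        embed (there (there e∈))  = [ G₂⊆attached (F⊆G₂ e∈) ]

      network : IsNetwork X M ℓ
      network = IsNetwork-moveReticulation net v-ret w∉N acyclic-M unique-M same-indeg same-outdeg v-isolated w-ret

  headMove-IsNetwork : IsNetwork X (headMove N (u , v) (s , t)) ℓ
  headMove-IsNetwork with indeg≡1⇒inEdges G₂ indeg-G₂-v | outdeg≡1⇒outEdges G₂ outdeg-G₂-v
  ... | _ , in≡ | _ , out≡ = subst (λ H → IsNetwork X H ℓ) (sym M-≡) network
    where open Suppressed in≡ out≡

mainTheorem10 : (X : Set) (N : Graph) (ℓ : X → ℕ) → IsNetwork X N ℓ →
    (u v s t : ℕ) → (u , v) ∈ N → (s , t) ∈ N →
    HeadMovable N (u , v) → u ≢ s → ¬ Above N t u →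
    IsNetwork X (headMove N (u , v) (s , t)) ℓ
-- The hypothesis (u , v) ∈ N is also part of HeadMovable N (u , v).
mainTheorem10 X N ℓ net u v s t _ st∈N movable u≢s t↛u = HeadMove.headMove-IsNetwork net movable st∈N u≢s t↛u
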